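{- Let $G$ be an extremal $3$-edge-colored complete graph on $n\ge 3$ vertices. Then for any pair of vertices $u,v\in V(G)$, \[ \binom{n-1}{2}\bigl(\mathrm{RBT}(u)-\mathrm{RBT}(v)\bigr)\le n-2 . \]
   Context: A triangle is rainbow if its three edges have distinct colors. A $3$-edge-colored complete graph on $n$ vertices is extremal if it has the maximum number of rainbow triangles among all $3$-edge-colorings of $K_n$. For a vertex $u$, $\mathrm{RBT}(u)$ is the number of rainbow triangles containing $u$ divided by $\binom{n-1}{2}$. -}

module Defs where

open import Data.Nat using (ℕ; _<_; _≤_; _+_; _∸_)
open import Data.Fin using (Fin; toℕ)
open import Data.List using (List; length; filter; allFin)
open import Data.Product using (_×_; _,_)
open import Relation.Nullary using (¬_; Dec)
open import Relation.Binary.PropositionalEquality using (_≡_)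

-- A 3-edge-coloring of the complete graph K_n on vertex set Fin n:
-- a colour for every ordered pair, symmetric. (Values on the diagonal
-- c i i are irrelevant: they are never used below.)
record Coloring (n : ℕ) : Set where
  field
    col  : Fin n → Fin n → Fin 3
    symm : ∀ i j → col i j ≡ col j i
open Coloring public

Distinct3 : Fin 3 → Fin 3 → Fin 3 → Set
Distinct3 a b c = (¬ a ≡ b) × (¬ a ≡ c) × (¬ b ≡ c)

Rainbow : ∀ {n} → Coloring n → Fin n → Fin n → Fin n → Set
Rainbow c i j k = Distinct3 (col c i j) (col c i k) (col c j k)

open import Data.Fin.Properties using (_≟_)
import Data.Nat.Properties as ℕP
open import Relation.Nullary.Decidable using (_×-dec_; ¬?)
open import Data.List using (cartesianProduct)

private
  dist? : ∀ a b c → Dec (Distinct3 a b c)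
  dist? a b c = ¬? (a ≟ b) ×-dec ¬? (a ≟ c) ×-dec ¬? (b ≟ c)

  rb? : ∀ {n} (c : Coloring n) i j k → Dec (Rainbow c i j k)
  rb? c i j k = dist? (col c i j) (col c i k) (col c j k)

triples : ∀ n → List (Fin n × Fin n × Fin n)
triples n = cartesianProduct (allFin n) (cartesianProduct (allFin n) (allFin n))

pairs : ∀ n → List (Fin n × Fin n)
pairs n = cartesianProduct (allFin n) (allFin n)

rainbowCount : ∀ {n} → Coloring n → ℕ
rainbowCount {n} c = length (filter
  (λ { (i , j , k) → (toℕ i ℕP.<? toℕ j ×-dec toℕ j ℕP.<? toℕ k) ×-dec rb? c i j k })
  (triples n))

-- number of rainbow triangles containing vertex u
-- (= binom(n-1,2) * RBT(u) in the paper's notation)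
rainbowAt : ∀ {n} → Coloring n → Fin n → ℕ
rainbowAt {n} c u = length (filter
  (λ { (j , k) → (toℕ j ℕP.<? toℕ k ×-dec ¬? (u ≟ j) ×-dec ¬? (u ≟ k)) ×-dec rb? c u j k })
  (pairs n))

Extremal : ∀ {n} → Coloring n → Set
Extremal {n} c = ∀ (c' : Coloring n) → rainbowCount c' ≤ rainbowCount c

-- Recolour v as a copy of u. Triangles avoiding v keep their colours, and the
-- rainbow triangles of any colouring split into those avoiding v and those
-- through v, so by extremality the clone has at most rainbowAt c v rainbow
-- triangles through v. On the other hand every rainbow triangle through u that
-- avoids v reappears through v in the clone, and at most n - 2 triangles contain
-- both u and v.

module Submission where

open import Defs
open import Data.Nat using (ℕ; zero; suc; _+_; _*_; _∸_; _≤_; _<_; z≤n)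
open import Data.Nat.Properties hiding (_≟_)
open import Data.Nat.ListAction as List using ()
open import Data.Nat.ListAction.Properties using (sum-++)
open import Data.Nat.Tactic.RingSolver using (solve-∀)
open import Algebra.Properties.Semiring.Sum +-*-semiring
  using (sum; sum-syntax; sum-cong-≗; sum-replicate-zero; ∑-distrib-+; *-distribˡ-sum)
open import Data.Bool using (true; false; if_then_else_)
open import Data.Empty using (⊥-elim)
open import Data.Fin using (Fin; toℕ) renaming (zero to fzero; suc to fsuc)
open import Data.Fin.Properties using (_≟_; toℕ-injective)
open import Data.List using (List; []; _∷_; length; filter; map; tabulate; allFin; cartesianProduct; _++_)
open import Data.List.Properties using (map-++; map-tabulate; map-∘)
open import Data.Product using (_×_; _,_)
open import Function using (_∘_; _⇔_; mk⇔; Equivalence)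
open import Relation.Nullary using (¬_; Dec; yes; no; does; _because_; ¬?; _×-dec_)
open import Relation.Unary using (Pred; Decidable)
open import Relation.Binary.Definitions using (Tri; tri<; tri≈; tri>)
open import Relation.Binary.PropositionalEquality

𝟙 : ∀ {P : Set} → Dec P → ℕ
𝟙 d = if does d then 1 else 0

𝟙-× : ∀ {P Q : Set} (p : Dec P) (q : Dec Q) → 𝟙 (p ×-dec q) ≡ 𝟙 p * 𝟙 q
𝟙-× (true because _) (true because _) = refl
𝟙-× (true because _) (false because _) = refl
𝟙-× (false because _) _ = refl

𝟙-cong : ∀ {P Q : Set} → P ⇔ Q → (p : Dec P) (q : Dec Q) → 𝟙 p ≡ 𝟙 q
𝟙-cong _ (yes _) (yes _) = refl
𝟙-cong P⇔Q (yes p) (no ¬q) = ⊥-elim (¬q (Equivalence.to P⇔Q p))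
𝟙-cong P⇔Q (no ¬p) (yes q) = ⊥-elim (¬p (Equivalence.from P⇔Q q))
𝟙-cong _ (no _) (no _) = refl

𝟙-yes : ∀ {P : Set} (p : Dec P) → P → 𝟙 p ≡ 1
𝟙-yes (yes _) _ = refl
𝟙-yes (no ¬p) p = ⊥-elim (¬p p)

𝟙-no : ∀ {P : Set} (p : Dec P) → ¬ P → 𝟙 p ≡ 0
𝟙-no (yes p) ¬p = ⊥-elim (¬p p)
𝟙-no (no _) _ = refl

𝟙≤1 : ∀ {P : Set} (p : Dec P) → 𝟙 p ≤ 1
𝟙≤1 (yes _) = ≤-refl
𝟙≤1 (no _) = z≤n

𝟙-¬?+𝟙 : ∀ {P : Set} (p : Dec P) → 𝟙 (¬? p) + 𝟙 p ≡ 1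
𝟙-¬?+𝟙 (yes _) = refl
𝟙-¬?+𝟙 (no _) = refl

𝟙-*-cong : ∀ {P : Set} (p : Dec P) {x y : ℕ} → (P → x ≡ y) → 𝟙 p * x ≡ 𝟙 p * y
𝟙-*-cong (yes p) x≡y = cong (1 *_) (x≡y p)
𝟙-*-cong (no _) _ = refl

𝟙-*-≤ : ∀ {P : Set} (p : Dec P) {x y : ℕ} → (P → x ≤ y) → 𝟙 p * x ≤ y
𝟙-*-≤ (yes p) x≤y = ≤-trans (≤-reflexive (*-identityˡ _)) (x≤y p)
𝟙-*-≤ (no _) _ = z≤n

*-≤1 : ∀ m {n} → n ≤ 1 → m * n ≤ m
*-≤1 m n≤1 = ≤-trans (*-monoʳ-≤ m n≤1) (≤-reflexive (*-identityʳ m))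

length-filter≡sum-𝟙 : ∀ {A : Set} {P : Pred A _} (P? : Decidable P) (xs : List A) →
  length (filter P? xs) ≡ List.sum (map (𝟙 ∘ P?) xs)
length-filter≡sum-𝟙 P? [] = refl
length-filter≡sum-𝟙 P? (x ∷ xs) with P? x
... | yes _ = cong suc (length-filter≡sum-𝟙 P? xs)
... | no _ = length-filter≡sum-𝟙 P? xs

sum-tabulate : ∀ {n} (f : Fin n → ℕ) → List.sum (tabulate f) ≡ ∑[ i < n ] f i
sum-tabulate {zero} f = refl
sum-tabulate {suc n} f = cong (f fzero +_) (sum-tabulate (f ∘ fsuc))

sum-map-allFin : ∀ {n} (f : Fin n → ℕ) → List.sum (map f (allFin n)) ≡ ∑[ i < n ] f i
sum-map-allFin f = trans (cong List.sum (map-tabulate (λ i → i) f)) (sum-tabulate f)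

sum-map-cartesianProduct : ∀ {A B : Set} (f : A × B → ℕ) (xs : List A) (ys : List B) →
  List.sum (map f (cartesianProduct xs ys)) ≡ List.sum (map (λ x → List.sum (map (λ y → f (x , y)) ys)) xs)
sum-map-cartesianProduct f [] ys = refl
sum-map-cartesianProduct f (x ∷ xs) ys = begin
  List.sum (map f (map (x ,_) ys ++ cartesianProduct xs ys))
    ≡⟨ cong List.sum (map-++ f (map (x ,_) ys) _) ⟩
  List.sum (map f (map (x ,_) ys) ++ map f (cartesianProduct xs ys))
    ≡⟨ sum-++ (map f (map (x ,_) ys)) _ ⟩
  List.sum (map f (map (x ,_) ys)) + List.sum (map f (cartesianProduct xs ys))
    ≡⟨ cong₂ _+_ (cong List.sum (sym (map-∘ ys))) (sum-map-cartesianProduct f xs ys) ⟩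
  List.sum (map (λ y → f (x , y)) ys) + List.sum (map (λ x → List.sum (map (λ y → f (x , y)) ys)) xs) ∎
  where open ≡-Reasoning

sum-map-pairs : ∀ n (f : Fin n × Fin n → ℕ) →
  List.sum (map f (pairs n)) ≡ ∑[ i < n ] ∑[ j < n ] f (i , j)
sum-map-pairs n f = trans (sum-map-cartesianProduct f (allFin n) (allFin n))
  (trans (sum-map-allFin (λ i → List.sum (map (λ j → f (i , j)) (allFin n))))
         (sum-cong-≗ λ i → sum-map-allFin (λ j → f (i , j))))

sum-map-triples : ∀ n (f : Fin n × Fin n × Fin n → ℕ) →
  List.sum (map f (triples n)) ≡ ∑[ i < n ] ∑[ j < n ] ∑[ k < n ] f (i , j , k)
sum-map-triples n f = trans (sum-map-cartesianProduct f (allFin n) (pairs n))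
  (trans (sum-map-allFin (λ i → List.sum (map (λ jk → f (i , jk)) (pairs n))))
         (sum-cong-≗ λ i → sum-map-pairs n (λ jk → f (i , jk))))

∑-mono-≤ : ∀ {n} {f g : Fin n → ℕ} → (∀ i → f i ≤ g i) → ∑[ i < n ] f i ≤ ∑[ i < n ] g i
∑-mono-≤ {zero} _ = z≤n
∑-mono-≤ {suc n} f≤g = +-mono-≤ (f≤g fzero) (∑-mono-≤ (f≤g ∘ fsuc))

∑-one : ∀ n → ∑[ i < n ] 1 ≡ n
∑-one zero = refl
∑-one (suc n) = cong suc (∑-one n)

δ : ∀ {n} → Fin n → Fin n → ℕ
δ v i = 𝟙 (v ≟ i)

δᶜ : ∀ {n} → Fin n → Fin n → ℕ
δᶜ v i = 𝟙 (¬? (v ≟ i))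

δᶜ-≢ : ∀ {n} {i j : Fin n} → ¬ i ≡ j → δᶜ i j ≡ 1
δᶜ-≢ {i = i} {j} = 𝟙-yes (¬? (i ≟ j))

∑-δ : ∀ {n} (v : Fin n) (f : Fin n → ℕ) → ∑[ i < n ] (δ v i * f i) ≡ f v
∑-δ {suc n} fzero f = begin
  1 * f fzero + ∑[ i < n ] 0 ≡⟨ cong (1 * f fzero +_) (sum-replicate-zero n) ⟩
  1 * f fzero + 0            ≡⟨ +-identityʳ _ ⟩
  1 * f fzero                ≡⟨ *-identityˡ _ ⟩
  f fzero                    ∎
  where open ≡-Reasoning
∑-δ {suc n} (fsuc v) f = ∑-δ v (f ∘ fsuc)

∑≠ : ∀ {n} → Fin n → (Fin n → ℕ) → ℕ
∑≠ {n} v f = ∑[ i < n ] (δᶜ v i * f i)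
infixl 10 ∑≠
syntax ∑≠ v (λ i → x) = ∑[ i ≢ v ] x

∑≠-cong : ∀ {n} (v : Fin n) {f g : Fin n → ℕ} → (∀ i → ¬ v ≡ i → f i ≡ g i) → ∑≠ v f ≡ ∑≠ v g
∑≠-cong v f≡g = sum-cong-≗ λ i → 𝟙-*-cong (¬? (v ≟ i)) (f≡g i)

∑≠-distrib-+ : ∀ {n} (v : Fin n) (f g : Fin n → ℕ) → ∑[ i ≢ v ] (f i + g i) ≡ ∑≠ v f + ∑≠ v g
∑≠-distrib-+ v f g = trans (sum-cong-≗ λ i → *-distribˡ-+ (δᶜ v i) (f i) (g i)) (∑-distrib-+ (λ i → δᶜ v i * f i) (λ i → δᶜ v i * g i))

∑-split : ∀ {n} (v : Fin n) (f : Fin n → ℕ) → ∑[ i < n ] f i ≡ ∑≠ v f + f v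
∑-split {n} v f = begin
  ∑[ i < n ] f i                                 ≡⟨ sum-cong-≗ split ⟩
  ∑[ i < n ] (δᶜ v i * f i + δ v i * f i)        ≡⟨ ∑-distrib-+ (λ i → δᶜ v i * f i) (λ i → δ v i * f i) ⟩
  ∑≠ v f + ∑[ i < n ] (δ v i * f i)              ≡⟨ cong (∑≠ v f +_) (∑-δ v f) ⟩
  ∑≠ v f + f v                                   ∎
  where
  open ≡-Reasoning
  split : ∀ i → f i ≡ δᶜ v i * f i + δ v i * f i
  split i = sym (trans (sym (*-distribʳ-+ (f i) (δᶜ v i) (δ v i)))
                       (trans (cong (_* f i) (𝟙-¬?+𝟙 (v ≟ i))) (*-identityˡ (f i))))

∑≠-≤-∑ : ∀ {n} (v : Fin n) {f g : Fin n → ℕ} → (∀ i → ¬ v ≡ i → f i ≤ g i) → ∑≠ v f ≤ ∑[ i < n ] g i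
∑≠-≤-∑ v f≤g = ∑-mono-≤ λ i → 𝟙-*-≤ (¬? (v ≟ i)) (f≤g i)

∑∑-distrib-+ : ∀ {m n} (f g : Fin m → Fin n → ℕ) →
  ∑[ i < m ] ∑[ j < n ] (f i j + g i j) ≡ ∑[ i < m ] ∑[ j < n ] f i j + ∑[ i < m ] ∑[ j < n ] g i j
∑∑-distrib-+ f g = trans (sum-cong-≗ λ i → ∑-distrib-+ (f i) (g i)) (∑-distrib-+ (λ i → sum (f i)) (λ i → sum (g i)))

∑≠≡∑∑ : ∀ {n} (v : Fin n) (f : Fin n → Fin n → ℕ) →
  ∑[ j ≢ v ] ∑[ k < n ] f j k ≡ ∑[ j < n ] ∑[ k < n ] (δᶜ v j * f j k)
∑≠≡∑∑ v f = sum-cong-≗ λ j → *-distribˡ-sum (δᶜ v j) (f j)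

∑≠∑≠≡∑∑ : ∀ {n} (v : Fin n) (f : Fin n → Fin n → ℕ) →
  ∑[ j ≢ v ] ∑[ k ≢ v ] f j k ≡ ∑[ j < n ] ∑[ k < n ] (δᶜ v j * (δᶜ v k * f j k))
∑≠∑≠≡∑∑ v f = sum-cong-≗ λ j → *-distribˡ-sum (δᶜ v j) (λ k → δᶜ v k * f j k)

∑²-split : ∀ {n} (v : Fin n) (f : Fin n → Fin n → ℕ) →
  ∑[ j < n ] ∑[ k < n ] f j k ≡ ∑[ j ≢ v ] ∑[ k ≢ v ] f j k + (∑[ j ≢ v ] f j v + ∑[ k < n ] f v k)
∑²-split {n} v f = begin
  ∑[ j < n ] ∑[ k < n ] f j k
    ≡⟨ ∑-split v _ ⟩
  ∑[ j ≢ v ] ∑[ k < n ] f j k + ∑[ k < n ] f v k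
    ≡⟨ cong (_+ ∑[ k < n ] f v k) (∑≠-cong v λ j _ → ∑-split v (f j)) ⟩
  ∑[ j ≢ v ] (∑[ k ≢ v ] f j k + f j v) + ∑[ k < n ] f v k
    ≡⟨ cong (_+ ∑[ k < n ] f v k) (∑≠-distrib-+ v _ _) ⟩
  ∑[ j ≢ v ] ∑[ k ≢ v ] f j k + ∑[ j ≢ v ] f j v + ∑[ k < n ] f v k
    ≡⟨ +-assoc (∑[ j ≢ v ] ∑[ k ≢ v ] f j k) (∑[ j ≢ v ] f j v) (∑[ k < n ] f v k) ⟩
  ∑[ j ≢ v ] ∑[ k ≢ v ] f j k + (∑[ j ≢ v ] f j v + ∑[ k < n ] f v k) ∎
  where open ≡-Reasoning

∑³-split : ∀ {n} (v : Fin n) (F : Fin n → Fin n → Fin n → ℕ) →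
  ∑[ i < n ] ∑[ j < n ] ∑[ k < n ] F i j k
    ≡ ∑[ i ≢ v ] ∑[ j ≢ v ] ∑[ k ≢ v ] F i j k
      + ∑[ j < n ] ∑[ k < n ] (δᶜ v j * (δᶜ v k * F j k v) + δᶜ v j * F j v k + F v j k)
∑³-split {n} v F = begin
  ∑[ i < n ] ∑[ j < n ] ∑[ k < n ] F i j k
    ≡⟨ ∑-split v _ ⟩
  ∑[ i ≢ v ] ∑[ j < n ] ∑[ k < n ] F i j k + S₁
    ≡⟨ cong (_+ S₁) (∑≠-cong v λ i _ → ∑-split v λ j → ∑[ k < n ] F i j k) ⟩
  ∑[ i ≢ v ] (∑[ j ≢ v ] ∑[ k < n ] F i j k + ∑[ k < n ] F i v k) + S₁
    ≡⟨ cong (_+ S₁) (∑≠-cong v λ i _ → cong (_+ ∑[ k < n ] F i v k) (∑≠-cong v λ j _ → ∑-split v (F i j))) ⟩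
  ∑[ i ≢ v ] (∑[ j ≢ v ] (∑[ k ≢ v ] F i j k + F i j v) + ∑[ k < n ] F i v k) + S₁
    ≡⟨ cong (_+ S₁) (∑≠-distrib-+ v _ _) ⟩
  ∑[ i ≢ v ] ∑[ j ≢ v ] (∑[ k ≢ v ] F i j k + F i j v) + S₂ + S₁
    ≡⟨ cong (λ x → x + S₂ + S₁) (trans (∑≠-cong v λ i _ → ∑≠-distrib-+ v _ _) (∑≠-distrib-+ v _ _)) ⟩
  A + S₃ + S₂ + S₁
    ≡⟨ trans (cong (_+ S₁) (+-assoc A S₃ S₂)) (+-assoc A (S₃ + S₂) S₁) ⟩
  A + (S₃ + S₂ + S₁)
    ≡⟨ cong (A +_) (sym through) ⟩
  A + ∑[ j < n ] ∑[ k < n ] (δᶜ v j * (δᶜ v k * F j k v) + δᶜ v j * F j v k + F v j k) ∎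
  where
  open ≡-Reasoning
  A S₁ S₂ S₃ : ℕ
  A = ∑[ i ≢ v ] ∑[ j ≢ v ] ∑[ k ≢ v ] F i j k
  S₁ = ∑[ j < n ] ∑[ k < n ] F v j k
  S₂ = ∑[ j ≢ v ] ∑[ k < n ] F j v k
  S₃ = ∑[ j ≢ v ] ∑[ k ≢ v ] F j k v
  through : ∑[ j < n ] ∑[ k < n ] (δᶜ v j * (δᶜ v k * F j k v) + δᶜ v j * F j v k + F v j k) ≡ S₃ + S₂ + S₁
  through = begin
    _ ≡⟨ ∑∑-distrib-+ (λ j k → δᶜ v j * (δᶜ v k * F j k v) + δᶜ v j * F j v k) (λ j k → F v j k) ⟩
    _ ≡⟨ cong (_+ S₁) (∑∑-distrib-+ (λ j k → δᶜ v j * (δᶜ v k * F j k v)) (λ j k → δᶜ v j * F j v k)) ⟩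
    _ ≡⟨ cong (_+ S₁) (sym (cong₂ _+_ (∑≠∑≠≡∑∑ v (λ j k → F j k v)) (∑≠≡∑∑ v (λ j k → F j v k)))) ⟩
    S₃ + S₂ + S₁ ∎

∑≠δᶜ≡n∸2 : ∀ {n} {u v : Fin n} → ¬ u ≡ v → ∑[ m ≢ v ] δᶜ u m ≡ n ∸ 2
∑≠δᶜ≡n∸2 {n} {u} {v} u≢v = sym (trans (cong (_∸ 2) n≡X+2) (m+n∸n≡m X 2))
  where
  open ≡-Reasoning
  X : ℕ
  X = ∑[ m ≢ v ] δᶜ u m
  n≡X+2 : n ≡ X + 2
  n≡X+2 = begin
    n                      ≡⟨ ∑-one n ⟨
    ∑[ m < n ] 1           ≡⟨ ∑-split u (λ _ → 1) ⟩
    ∑[ m ≢ u ] 1 + 1       ≡⟨ cong (_+ 1) (sum-cong-≗ λ m → *-identityʳ (δᶜ u m)) ⟩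
    ∑[ m < n ] δᶜ u m + 1  ≡⟨ cong (_+ 1) (∑-split v (δᶜ u)) ⟩
    X + δᶜ u v + 1         ≡⟨ cong (λ x → X + x + 1) (δᶜ-≢ u≢v) ⟩
    X + 1 + 1              ≡⟨ +-assoc X 1 1 ⟩
    X + 2                  ∎

lt : ∀ {n} → Fin n → Fin n → ℕ
lt i j = 𝟙 (toℕ i <? toℕ j)

lt-< : ∀ {n} {i j : Fin n} → toℕ i < toℕ j → lt i j ≡ 1
lt-< {i = i} {j} = 𝟙-yes (toℕ i <? toℕ j)

lt-≮ : ∀ {n} {i j : Fin n} → ¬ toℕ i < toℕ j → lt i j ≡ 0
lt-≮ {i = i} {j} = 𝟙-no (toℕ i <? toℕ j)

lt+lt≡δᶜ : ∀ {n} (i j : Fin n) → lt j i + lt i j ≡ δᶜ i j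
lt+lt≡δᶜ i j with <-cmp (toℕ i) (toℕ j)
... | tri< i<j _ j≮i rewrite lt-< i<j | lt-≮ j≮i | δᶜ-≢ (λ i≡j → <-irrefl (cong toℕ i≡j) i<j) = refl
... | tri> i≮j _ j<i rewrite lt-≮ i≮j | lt-< j<i | δᶜ-≢ (λ i≡j → <-irrefl (cong toℕ (sym i≡j)) j<i) = refl
... | tri≈ i≮j i≡j _ with toℕ-injective i≡j
...   | refl rewrite lt-≮ i≮j = sym (𝟙-no (¬? (i ≟ i)) (λ i≢i → i≢i refl))

-- The three terms count the positions of v before, between and after j < k.
insertion-positions : ∀ {n} {v j k : Fin n} → ¬ v ≡ j → ¬ v ≡ k → ¬ j ≡ k →
  lt j k * lt k v + lt j v * lt v k + lt v j * lt j k ≡ lt j k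
insertion-positions {v = v} {j} {k} v≢j v≢k j≢k =
  by-order (<-cmp (toℕ v) (toℕ j)) (<-cmp (toℕ j) (toℕ k)) (<-cmp (toℕ v) (toℕ k))
  where
  Positions : (vj jv jk vk kv : ℕ) → Set
  Positions vj jv jk vk kv = jk * kv + jv * vk + vj * jk ≡ jk

  evaluate : ∀ {vj jv jk vk kv vj′ jv′ jk′ vk′ kv′} →
    vj ≡ vj′ → jv ≡ jv′ → jk ≡ jk′ → vk ≡ vk′ → kv ≡ kv′ →
    Positions vj′ jv′ jk′ vk′ kv′ → Positions vj jv jk vk kv
  evaluate refl refl refl refl refl p = p

  by-order : Tri (toℕ v < toℕ j) (toℕ v ≡ toℕ j) (toℕ j < toℕ v) →
             Tri (toℕ j < toℕ k) (toℕ j ≡ toℕ k) (toℕ k < toℕ j) →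
             Tri (toℕ v < toℕ k) (toℕ v ≡ toℕ k) (toℕ k < toℕ v) →
             Positions (lt v j) (lt j v) (lt j k) (lt v k) (lt k v)
  by-order (tri≈ _ e _) _ _ = ⊥-elim (v≢j (toℕ-injective e))
  by-order _ (tri≈ _ e _) _ = ⊥-elim (j≢k (toℕ-injective e))
  by-order _ _ (tri≈ _ e _) = ⊥-elim (v≢k (toℕ-injective e))
  by-order (tri< v<j _ _) (tri< j<k _ _) (tri> _ _ k<v) = ⊥-elim (<-asym (<-trans v<j j<k) k<v)
  by-order (tri> _ _ j<v) (tri> _ _ k<j) (tri< v<k _ _) = ⊥-elim (<-asym (<-trans k<j j<v) v<k)
  by-order (tri< v<j _ j≮v) (tri< j<k _ _) (tri< v<k _ k≮v) =
    evaluate (lt-< v<j) (lt-≮ j≮v) (lt-< j<k) (lt-< v<k) (lt-≮ k≮v) refl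
  by-order (tri< v<j _ j≮v) (tri> j≮k _ _) (tri< v<k _ k≮v) =
    evaluate (lt-< v<j) (lt-≮ j≮v) (lt-≮ j≮k) (lt-< v<k) (lt-≮ k≮v) refl
  by-order (tri< v<j _ j≮v) (tri> j≮k _ _) (tri> v≮k _ k<v) =
    evaluate (lt-< v<j) (lt-≮ j≮v) (lt-≮ j≮k) (lt-≮ v≮k) (lt-< k<v) refl
  by-order (tri> v≮j _ j<v) (tri< j<k _ _) (tri< v<k _ k≮v) =
    evaluate (lt-≮ v≮j) (lt-< j<v) (lt-< j<k) (lt-< v<k) (lt-≮ k≮v) refl
  by-order (tri> v≮j _ j<v) (tri< j<k _ _) (tri> v≮k _ k<v) =
    evaluate (lt-≮ v≮j) (lt-< j<v) (lt-< j<k) (lt-≮ v≮k) (lt-< k<v) refl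
  by-order (tri> v≮j _ j<v) (tri> j≮k _ _) (tri> v≮k _ k<v) =
    evaluate (lt-≮ v≮j) (lt-< j<v) (lt-≮ j≮k) (lt-≮ v≮k) (lt-< k<v) refl

distinct? : ∀ a b d → Dec (Distinct3 a b d)
distinct? a b d = ¬? (a ≟ b) ×-dec ¬? (a ≟ d) ×-dec ¬? (b ≟ d)

rainbow? : ∀ {n} (c : Coloring n) i j k → Dec (Rainbow c i j k)
rainbow? c i j k = distinct? (col c i j) (col c i k) (col c j k)

rb : ∀ {n} → Coloring n → Fin n → Fin n → Fin n → ℕ
rb c i j k = 𝟙 (rainbow? c i j k)

triangle : ∀ {n} → Coloring n → Fin n → Fin n → Fin n → ℕ
triangle c i j k = lt i j * lt j k * rb c i j k

triangleAt : ∀ {n} → Coloring n → Fin n → Fin n → Fin n → ℕ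
triangleAt c u j k = lt j k * (δᶜ u j * δᶜ u k) * rb c u j k

rainbowCount≡∑triangle : ∀ {n} (c : Coloring n) →
  rainbowCount c ≡ ∑[ i < n ] ∑[ j < n ] ∑[ k < n ] triangle c i j k
rainbowCount≡∑triangle {n} c =
  trans (length-filter≡sum-𝟙 _ (triples n)) (trans (sum-map-triples n _)
    (sum-cong-≗ λ i → sum-cong-≗ λ j → sum-cong-≗ λ k →
      trans (𝟙-× (toℕ i <? toℕ j ×-dec toℕ j <? toℕ k) (rainbow? c i j k))
            (cong (_* rb c i j k) (𝟙-× (toℕ i <? toℕ j) (toℕ j <? toℕ k)))))

rainbowAt≡∑triangleAt : ∀ {n} (c : Coloring n) u →
  rainbowAt c u ≡ ∑[ j < n ] ∑[ k < n ] triangleAt c u j k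
rainbowAt≡∑triangleAt {n} c u =
  trans (length-filter≡sum-𝟙 _ (pairs n)) (trans (sum-map-pairs n _)
    (sum-cong-≗ λ j → sum-cong-≗ λ k →
      trans (𝟙-× (toℕ j <? toℕ k ×-dec ¬? (u ≟ j) ×-dec ¬? (u ≟ k)) (rainbow? c u j k))
            (cong (_* rb c u j k)
                  (trans (𝟙-× (toℕ j <? toℕ k) (¬? (u ≟ j) ×-dec ¬? (u ≟ k)))
                         (cong (lt j k *_) (𝟙-× (¬? (u ≟ j)) (¬? (u ≟ k))))))))

module _ {n} (c : Coloring n) where

  Rainbow-swap₁₂ : ∀ {i j k} → Rainbow c i j k → Rainbow c j i k
  Rainbow-swap₁₂ {i} {j} (p , q , r) =
    (λ e → q (trans (symm c i j) e)) , (λ e → p (trans (symm c i j) e)) , (λ e → r (sym e))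

  Rainbow-swap₂₃ : ∀ {i j k} → Rainbow c i j k → Rainbow c i k j
  Rainbow-swap₂₃ {_} {j} {k} (p , q , r) =
    (λ e → p (sym e)) , (λ e → r (trans e (symm c k j))) , (λ e → q (trans e (symm c k j)))

  rb-swap₁₂ : ∀ i j k → rb c i j k ≡ rb c j i k
  rb-swap₁₂ i j k = 𝟙-cong (mk⇔ Rainbow-swap₁₂ Rainbow-swap₁₂) (rainbow? c i j k) (rainbow? c j i k)

  rb-swap₂₃ : ∀ i j k → rb c i j k ≡ rb c i k j
  rb-swap₂₃ i j k = 𝟙-cong (mk⇔ Rainbow-swap₂₃ Rainbow-swap₂₃) (rainbow? c i j k) (rainbow? c i k j)

  Rainbow⇒distinct : ∀ {i j k} → Rainbow c i j k → ¬ i ≡ j × ¬ i ≡ k × ¬ j ≡ k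
  Rainbow⇒distinct {i} {j} (p , q , r) =
    (λ { refl → r refl }) , (λ { refl → q (symm c i j) }) , (λ { refl → p refl })

𝟙-distinct?-cong : ∀ {a a′ b b′ d d′} → a ≡ a′ → b ≡ b′ → d ≡ d′ → 𝟙 (distinct? a b d) ≡ 𝟙 (distinct? a′ b′ d′)
𝟙-distinct?-cong refl refl refl = refl

triangles-through : ∀ {n} (c : Coloring n) v j k →
  δᶜ v j * (δᶜ v k * triangle c j k v) + δᶜ v j * triangle c j v k + triangle c v j k ≡ triangleAt c v j k
triangles-through c v j k = begin
  δᶜ v j * (δᶜ v k * (lt j k * lt k v * rb c j k v)) + δᶜ v j * (lt j v * lt v k * rb c j v k) + lt v j * lt j k * r
    ≡⟨ cong₂ (λ p q → δᶜ v j * (δᶜ v k * (lt j k * lt k v * p)) + δᶜ v j * (lt j v * lt v k * q) + lt v j * lt j k * r)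
             (trans (rb-swap₂₃ c j k v) (rb-swap₁₂ c j v k)) (rb-swap₁₂ c j v k) ⟩
  δᶜ v j * (δᶜ v k * (lt j k * lt k v * r)) + δᶜ v j * (lt j v * lt v k * r) + lt v j * lt j k * r
    ≡⟨ factor (δᶜ v j) (δᶜ v k) (lt j k * lt k v) (lt j v * lt v k) (lt v j * lt j k) r ⟩
  r * (δᶜ v j * (δᶜ v k * (lt j k * lt k v)) + δᶜ v j * (lt j v * lt v k) + lt v j * lt j k)
    ≡⟨ 𝟙-*-cong (rainbow? c v j k) positions ⟩
  r * (lt j k * (δᶜ v j * δᶜ v k))
    ≡⟨ *-comm r _ ⟩
  triangleAt c v j k ∎
  where
  open ≡-Reasoning
  r : ℕ
  r = rb c v j k

  factor : ∀ x y a b d r → x * (y * (a * r)) + x * (b * r) + d * r ≡ r * (x * (y * a) + x * b + d)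
  factor = solve-∀

  drop-ones : ∀ {x y} a b d → x ≡ 1 → y ≡ 1 → x * (y * a) + x * b + d ≡ (a + b + d) * (x * y)
  drop-ones a b d refl refl = ones a b d
    where
    ones : ∀ a b d → 1 * (1 * a) + 1 * b + d ≡ (a + b + d) * (1 * 1)
    ones = solve-∀

  positions : Rainbow c v j k →
    δᶜ v j * (δᶜ v k * (lt j k * lt k v)) + δᶜ v j * (lt j v * lt v k) + lt v j * lt j k ≡ lt j k * (δᶜ v j * δᶜ v k)
  positions rainbow with Rainbow⇒distinct c rainbow
  ... | v≢j , v≢k , j≢k =
    trans (drop-ones _ _ _ (δᶜ-≢ v≢j) (δᶜ-≢ v≢k)) (cong (_* (δᶜ v j * δᶜ v k)) (insertion-positions v≢j v≢k j≢k))

triangleAt-≤ˡ : ∀ {n} (c : Coloring n) u j k → triangleAt c u j k ≤ lt j k * δᶜ u j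
triangleAt-≤ˡ c u j k =
  ≤-trans (*-≤1 _ (𝟙≤1 (rainbow? c u j k))) (*-monoʳ-≤ (lt j k) (*-≤1 (δᶜ u j) (𝟙≤1 (¬? (u ≟ k)))))

triangleAt-≤ʳ : ∀ {n} (c : Coloring n) u j k → triangleAt c u j k ≤ lt j k * δᶜ u k
triangleAt-≤ʳ c u j k =
  ≤-trans (*-≤1 _ (𝟙≤1 (rainbow? c u j k)))
          (*-monoʳ-≤ (lt j k) (≤-trans (*-monoˡ-≤ (δᶜ u k) (𝟙≤1 (¬? (u ≟ j)))) (≤-reflexive (*-identityˡ _))))

-- Triangles avoiding a vertex

avoiding : ∀ {n} → Coloring n → Fin n → ℕ
avoiding c v = ∑[ i ≢ v ] ∑[ j ≢ v ] ∑[ k ≢ v ] triangle c i j k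

rainbowCount≡avoiding+rainbowAt : ∀ {n} (c : Coloring n) v → rainbowCount c ≡ avoiding c v + rainbowAt c v
rainbowCount≡avoiding+rainbowAt {n} c v = begin
  rainbowCount c
    ≡⟨ rainbowCount≡∑triangle c ⟩
  ∑[ i < n ] ∑[ j < n ] ∑[ k < n ] triangle c i j k
    ≡⟨ ∑³-split v (triangle c) ⟩
  avoiding c v + ∑[ j < n ] ∑[ k < n ] (δᶜ v j * (δᶜ v k * triangle c j k v) + δᶜ v j * triangle c j v k + triangle c v j k)
    ≡⟨ cong (avoiding c v +_) (sum-cong-≗ λ j → sum-cong-≗ λ k → triangles-through c v j k) ⟩
  avoiding c v + ∑[ j < n ] ∑[ k < n ] triangleAt c v j k
    ≡⟨ cong (avoiding c v +_) (sym (rainbowAt≡∑triangleAt c v)) ⟩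
  avoiding c v + rainbowAt c v ∎
  where open ≡-Reasoning

AgreeOff : ∀ {n} → Fin n → Coloring n → Coloring n → Set
AgreeOff v c c′ = ∀ i j → ¬ v ≡ i → ¬ v ≡ j → col c i j ≡ col c′ i j

avoiding-cong : ∀ {n} {c c′ : Coloring n} v → AgreeOff v c c′ → avoiding c v ≡ avoiding c′ v
avoiding-cong v agree =
  ∑≠-cong v λ i v≢i → ∑≠-cong v λ j v≢j → ∑≠-cong v λ k v≢k →
    cong (lt i j * lt j k *_) (𝟙-distinct?-cong (agree i j v≢i v≢j) (agree i k v≢i v≢k) (agree j k v≢j v≢k))

Extremal⇒rainbowAt-maximal : ∀ {n} (c c′ : Coloring n) v → Extremal c → AgreeOff v c′ c → rainbowAt c′ v ≤ rainbowAt c v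
Extremal⇒rainbowAt-maximal c c′ v extremal agree = +-cancelˡ-≤ (avoiding c v) _ _ (begin
  avoiding c v + rainbowAt c′ v   ≡⟨ cong (_+ rainbowAt c′ v) (avoiding-cong {c = c′} {c} v agree) ⟨
  avoiding c′ v + rainbowAt c′ v  ≡⟨ rainbowCount≡avoiding+rainbowAt c′ v ⟨
  rainbowCount c′                 ≤⟨ extremal c′ ⟩
  rainbowCount c                  ≡⟨ rainbowCount≡avoiding+rainbowAt c v ⟩
  avoiding c v + rainbowAt c v    ∎)
  where open ≤-Reasoning

-- Cloning a vertex

redirect : ∀ {n} → Fin n → Fin n → Fin n → Fin n
redirect v u i with v ≟ i
... | yes _ = u
... | no _ = i

redirect-self : ∀ {n} (v u : Fin n) → redirect v u v ≡ u
redirect-self v u with v ≟ v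
... | yes _ = refl
... | no v≢v = ⊥-elim (v≢v refl)

redirect-other : ∀ {n} {v i : Fin n} (u : Fin n) → ¬ v ≡ i → redirect v u i ≡ i
redirect-other {v = v} {i} u v≢i with v ≟ i
... | yes v≡i = ⊥-elim (v≢i v≡i)
... | no _ = refl

-- v becomes a copy of u; the edge uv gets the diagonal colour col c u u, which no triangle reads.
clone : ∀ {n} → Coloring n → Fin n → Fin n → Coloring n
clone c u v = record
  { col = λ i j → col c (redirect v u i) (redirect v u j)
  ; symm = λ i j → symm c (redirect v u i) (redirect v u j)
  }

clone-agreeOff : ∀ {n} (c : Coloring n) u v → AgreeOff v (clone c u v) c
clone-agreeOff c u v i j v≢i v≢j = cong₂ (col c) (redirect-other u v≢i) (redirect-other u v≢j)

rb-clone : ∀ {n} (c : Coloring n) u {v j k} → ¬ v ≡ j → ¬ v ≡ k → rb (clone c u v) v j k ≡ rb c u j k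
rb-clone c u {v} v≢j v≢k = 𝟙-distinct?-cong
  (cong₂ (col c) (redirect-self v u) (redirect-other u v≢j))
  (cong₂ (col c) (redirect-self v u) (redirect-other u v≢k))
  (cong₂ (col c) (redirect-other u v≢j) (redirect-other u v≢k))

triangleAt-clone : ∀ {n} (c : Coloring n) u {v j k} → ¬ v ≡ j → ¬ v ≡ k →
  triangleAt c u j k ≤ triangleAt (clone c u v) v j k
triangleAt-clone c u {v} {j} {k} v≢j v≢k = begin
  lt j k * (δᶜ u j * δᶜ u k) * rb c u j k
    ≤⟨ *-monoˡ-≤ (rb c u j k) (*-monoʳ-≤ (lt j k) (*-mono-≤ (𝟙≤1 (¬? (u ≟ j))) (𝟙≤1 (¬? (u ≟ k))))) ⟩
  lt j k * 1 * rb c u j k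
    ≡⟨ cong₂ (λ x y → lt j k * x * y) (cong₂ _*_ (δᶜ-≢ v≢j) (δᶜ-≢ v≢k)) (rb-clone c u v≢j v≢k) ⟨
  triangleAt (clone c u v) v j k ∎
  where open ≤-Reasoning

rainbowAt-≤-clone : ∀ {n} (c : Coloring n) {u v} → ¬ u ≡ v → rainbowAt c u ≤ rainbowAt (clone c u v) v + (n ∸ 2)
rainbowAt-≤-clone {n} c {u} {v} u≢v = begin
  rainbowAt c u
    ≡⟨ rainbowAt≡∑triangleAt c u ⟩
  ∑[ j < n ] ∑[ k < n ] triangleAt c u j k
    ≡⟨ ∑²-split v (triangleAt c u) ⟩
  ∑[ j ≢ v ] ∑[ k ≢ v ] triangleAt c u j k + (∑[ j ≢ v ] triangleAt c u j v + ∑[ k < n ] triangleAt c u v k)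
    ≤⟨ +-mono-≤ (∑≠-≤-∑ v λ j v≢j → ∑≠-≤-∑ v λ k v≢k → triangleAt-clone c u v≢j v≢k) through-v ⟩
  ∑[ j < n ] ∑[ k < n ] triangleAt (clone c u v) v j k + (n ∸ 2)
    ≡⟨ cong (_+ (n ∸ 2)) (rainbowAt≡∑triangleAt (clone c u v) v) ⟨
  rainbowAt (clone c u v) v + (n ∸ 2) ∎
  where
  open ≤-Reasoning
  through-v : ∑[ j ≢ v ] triangleAt c u j v + ∑[ k < n ] triangleAt c u v k ≤ n ∸ 2
  through-v = begin
    ∑[ j ≢ v ] triangleAt c u j v + ∑[ k < n ] triangleAt c u v k
      ≤⟨ +-mono-≤ (∑≠-≤-∑ v λ j _ → triangleAt-≤ˡ c u j v) (∑-mono-≤ λ k → triangleAt-≤ʳ c u v k) ⟩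
    ∑[ m < n ] (lt m v * δᶜ u m) + ∑[ m < n ] (lt v m * δᶜ u m)
      ≡⟨ ∑-distrib-+ (λ m → lt m v * δᶜ u m) (λ m → lt v m * δᶜ u m) ⟨
    ∑[ m < n ] (lt m v * δᶜ u m + lt v m * δᶜ u m)
      ≡⟨ sum-cong-≗ (λ m → trans (sym (*-distribʳ-+ (δᶜ u m) (lt m v) (lt v m))) (cong (_* δᶜ u m) (lt+lt≡δᶜ v m))) ⟩
    ∑[ m ≢ v ] δᶜ u m
      ≡⟨ ∑≠δᶜ≡n∸2 u≢v ⟩
    n ∸ 2 ∎

proposition4p2 : ∀ (n : ℕ) → 3 ≤ n → (c : Coloring n) → Extremal c →
    ∀ (u v : Fin n) → rainbowAt c u ≤ rainbowAt c v + (n ∸ 2)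
proposition4p2 n _ c extremal u v with u ≟ v
... | yes refl = m≤m+n (rainbowAt c u) (n ∸ 2)
... | no u≢v = begin
  rainbowAt c u                        ≤⟨ rainbowAt-≤-clone c u≢v ⟩
  rainbowAt (clone c u v) v + (n ∸ 2)  ≤⟨ +-monoˡ-≤ (n ∸ 2) clone-no-better ⟩
  rainbowAt c v + (n ∸ 2)              ∎
  where
  open ≤-Reasoning
  clone-no-better : rainbowAt (clone c u v) v ≤ rainbowAt c v
  clone-no-better = Extremal⇒rainbowAt-maximal c (clone c u v) v extremal (clone-agreeOff c u v)
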